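{- Let $k \ge 4$ and $\ell \ge 1$. Let $G$ be a $k$-$\gamma_c$-critical graph having a maximal complete subgraph $H$ of order at least $2$ such that (a) every vertex of $G$ belongs to some minimum connected dominating set of $G$ that contains a vertex of $H$, and (b) for every pair of non-adjacent vertices $u,v$ of $G$ there is a connected dominating set $D'_{uv}$ of $G+uv$ with $D'_{uv}\cap V(H)\ne\emptyset$ and $|D'_{uv}|<k$. Let $n_1,\dots,n_\ell\ge1$, let $G_1,\dots,G_\ell$ be vertex-disjoint complete graphs with $G_i\cong K_{n_i}$, and let $x_0$ be a new vertex. Let $G^*$ be the graph obtained from the disjoint union of $x_0$, $G_1,\dots,G_\ell$ and $G$ by joining $x_0$ to every vertex of $G_1$, joining every vertex of $G_i$ to every vertex of $G_{i+1}$ for $i\in[\ell-1]$, and joining every vertex of $G_\ell$ to every vertex of $H$. Then $G^*$ is $(k+\ell)$-$\gamma_c$-critical.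
   Context: Graphs are finite and simple. For a connected graph $G$, a connected dominating set is a set $S\subseteq V(G)$ such that every vertex outside $S$ has a neighbor in $S$ and $G[S]$ is connected; $\gamma_c(G)$ is the minimum size of such a set, and a minimum one is a $\gamma_c$-set. A connected graph $G$ is $k$-$\gamma_c$-critical if $\gamma_c(G)=k$ and $\gamma_c(G+uv)<k$ for every pair of non-adjacent vertices $u,v$. -}

module Defs where

open import Data.Nat using (ℕ; zero; suc; _+_; _≤_; _<_; _≡ᵇ_)
open import Data.Bool using (Bool; true; false; _∨_; _∧_; if_then_else_)
open import Data.Fin using (Fin; toℕ; splitAt)
open import Data.Fin.Properties using (_≟_)
open import Data.Fin.Subset using (Subset; _∈_; _∉_; ∣_∣; ⊤)
open import Data.Vec using (Vec; lookup; sum)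
open import Data.Sum using (_⊎_; inj₁; inj₂)
open import Data.Product using (Σ; _×_; ∃; ∃-syntax)
open import Relation.Binary.PropositionalEquality using (_≡_; _≢_)
open import Relation.Nullary.Decidable using (⌊_⌋)

Adj : ℕ → Set
Adj n = Fin n → Fin n → Bool

IsSimple : ∀ {n} → Adj n → Set
IsSimple {n} G = (∀ (u v : Fin n) → G u v ≡ G v u) × (∀ (v : Fin n) → G v v ≡ false)

addEdge : ∀ {n} → Adj n → Fin n → Fin n → Adj n
addEdge G u v a b =
  G a b ∨ (⌊ a ≟ u ⌋ ∧ ⌊ b ≟ v ⌋) ∨ (⌊ a ≟ v ⌋ ∧ ⌊ b ≟ u ⌋)

data WalkIn {n} (G : Adj n) (S : Subset n) : Fin n → Fin n → Set where
  stop : ∀ {u} → u ∈ S → WalkIn G S u u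
  step : ∀ {u v w} → u ∈ S → G u v ≡ true → WalkIn G S v w → WalkIn G S u w

InducesConnected : ∀ {n} → Adj n → Subset n → Set
InducesConnected {n} G S = ∀ (u v : Fin n) → u ∈ S → v ∈ S → WalkIn G S u v

-- G is connected (nonempty and any two vertices joined by a walk)
Connected : ∀ {n} → Adj n → Set
Connected {n} G = Fin n × InducesConnected G ⊤

Dominating : ∀ {n} → Adj n → Subset n → Set
Dominating {n} G S = ∀ (v : Fin n) → v ∈ S ⊎ (∃[ u ] (u ∈ S × G u v ≡ true))

IsCDS : ∀ {n} → Adj n → Subset n → Set
IsCDS G S = Dominating G S × InducesConnected G S

GammaC≡ : ∀ {n} → Adj n → ℕ → Set
GammaC≡ {n} G k =
  (∃[ S ] (IsCDS G S × ∣ S ∣ ≡ k)) × (∀ (S : Subset n) → IsCDS G S → k ≤ ∣ S ∣)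

Critical : ∀ {n} → Adj n → ℕ → Set
Critical {n} G k =
  IsSimple G × Connected G × GammaC≡ G k ×
  (∀ (u v : Fin n) → u ≢ v → G u v ≡ false →
     ∃[ m ] (GammaC≡ (addEdge G u v) m × m < k))

IsMaximalClique : ∀ {n} → Adj n → Subset n → Set
IsMaximalClique {n} G H =
  (∀ (u v : Fin n) → u ∈ H → v ∈ H → u ≢ v → G u v ≡ true) ×
  (∀ (w : Fin n) → w ∉ H → ∃[ u ] (u ∈ H × G u w ≡ false))

-- The construction G*.
-- Vertex set Fin (suc (sum ns + n)):  0 = x₀, then the blocks
-- G₁,…,G_ℓ (block i has ns[i] vertices, in order), then the vertices of G.

data Kind (ℓ n : ℕ) : Set where
  x₀  : Kind ℓ n
  blk : Fin ℓ → Kind ℓ n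
  old : Fin n → Kind ℓ n

blockOf : ∀ {ℓ} (ns : Vec ℕ ℓ) → Fin (sum ns) → Fin ℓ
blockOf {suc ℓ} (m Data.Vec.∷ ns) x with splitAt m x
... | inj₁ _ = Fin.zero
... | inj₂ y = Fin.suc (blockOf ns y)

kind : ∀ {ℓ n} (ns : Vec ℕ ℓ) → Fin (suc (sum ns + n)) → Kind ℓ n
kind ns Fin.zero = x₀
kind ns (Fin.suc y) with splitAt (sum ns) y
... | inj₁ b = blk (blockOf ns b)
... | inj₂ v = old v

-- adjacency between kinds (for distinct vertices)
kindAdj : ∀ {ℓ n} → Adj n → Subset n → Kind ℓ n → Kind ℓ n → Bool
kindAdj G H x₀ x₀ = false
kindAdj G H x₀ (blk i) = toℕ i ≡ᵇ 0
kindAdj G H x₀ (old v) = false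
kindAdj G H (blk i) x₀ = toℕ i ≡ᵇ 0
kindAdj {ℓ} G H (blk i) (blk j) =
  (toℕ i ≡ᵇ toℕ j) ∨ (suc (toℕ i) ≡ᵇ toℕ j) ∨ (suc (toℕ j) ≡ᵇ toℕ i)
kindAdj {ℓ} G H (blk i) (old v) = (suc (toℕ i) ≡ᵇ ℓ) ∧ lookup H v
kindAdj G H (old v) x₀ = false
kindAdj {ℓ} G H (old v) (blk i) = (suc (toℕ i) ≡ᵇ ℓ) ∧ lookup H v
kindAdj G H (old u) (old v) = G u v

Gstar : ∀ {ℓ n} → Adj n → Subset n → (ns : Vec ℕ ℓ) → Adj (suc (sum ns + n))
Gstar G H ns a b = if ⌊ a ≟ b ⌋ then false else kindAdj G H (kind ns a) (kind ns b)

-- Give x₀, the blocks G₁, …, G_ℓ and the vertices of G the levels 0, 1, …, ℓ and ℓ + 1; along an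
-- edge of G* the level changes by at most one. A connected dominating set D of G* contains a
-- vertex of level ≤ 1 (to dominate x₀) and, since γc(G) > 1, a vertex of G, so it meets every block.
-- Its trace on G is a connected dominating set of G: a walk in G*[D] can leave G only through G_ℓ,
-- hence leaves and re-enters G inside the clique H. So γc(G*) ≥ k + ℓ, with equality for a
-- γc-set of G meeting H plus one vertex from each block.
-- For a non-edge ab of G*, a connected dominating set of G* + ab with k + ℓ − 1 vertices is
-- either a small connected dominating set of some G + uv meeting H, plus one vertex from each
-- block, or a γc-set of G meeting H plus one vertex from each block but one, the skipped block
-- being dominated thanks to the new edge ab.

module Submission where

open import Defs
open import Data.Nat using (ℕ; zero; suc; _+_; _∸_; _≤_; _<_; z≤n; s≤s; _≡ᵇ_; _≤?_) renaming (_≟_ to _≟ℕ_)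
open import Data.Nat.Properties hiding (_≟_)
open import Data.Fin using (Fin; zero; suc; toℕ; splitAt; _↑ˡ_; _↑ʳ_; fromℕ<)
open import Data.Fin.Properties
  using ( _≟_; any?; all?; splitAt-↑ˡ; splitAt-↑ʳ; splitAt⁻¹-↑ˡ; splitAt⁻¹-↑ʳ
        ; toℕ-injective; toℕ<n; toℕ-fromℕ<; ↑ˡ-injective; ↑ʳ-injective)
  renaming (suc-injective to Fin-suc-injective)
open import Data.Fin.Subset using (Subset; _∈_; _∉_; ∣_∣; ⊤; ⁅_⁆) renaming (⊥ to ∅)
open import Data.Fin.Subset.Properties
  using (_∈?_; anySubset?; ∣⊥∣≡0; ∣⁅x⁆∣≡1; x∈⁅x⁆; x∈⁅y⁆⇒x≡y; ∉⊥; ∣p∣≤∣x∷p∣; ∈⊤)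
open import Data.Vec using (Vec; lookup; sum; tabulate; _∷_; []; _[_]≔_; here; there)
open import Data.Vec.Properties
  using ([]=⇒lookup; lookup⇒[]=; lookup∘update; lookup∘update′; lookup∘tabulate; tabulate-cong; tabulate∘lookup)
open import Data.Bool using (Bool; true; false; _∨_; _∧_; not) renaming (_≟_ to _≟ᵇ_)
open import Data.Bool.Properties using (∨-comm; ∧-comm; T-≡)
open import Data.Sum using (_⊎_; inj₁; inj₂; [_,_]′)
open import Data.Product using (_×_; _,_; proj₁; proj₂; ∃-syntax)
open import Data.Empty using (⊥; ⊥-elim)
open import Function using (_∘_; Equivalence)
open import Relation.Binary.PropositionalEquality
  using (_≡_; _≢_; refl; sym; trans; cong; cong₂; subst; module ≡-Reasoning)
open import Relation.Nullary using (Dec; yes; no; does)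
open import Relation.Nullary.Decidable using (⌊_⌋; _×-dec_; _⊎-dec_; _→-dec_)
open import Relation.Binary.Definitions using (tri<; tri≈; tri>)

∨-introˡ : ∀ {x} y → x ≡ true → x ∨ y ≡ true
∨-introˡ y refl = refl

∨-introʳ : ∀ x {y} → y ≡ true → x ∨ y ≡ true
∨-introʳ true  _ = refl
∨-introʳ false e = e

∨-elim : ∀ {x y} → x ∨ y ≡ true → x ≡ true ⊎ y ≡ true
∨-elim {true}  _ = inj₁ refl
∨-elim {false} e = inj₂ e

∧-elim : ∀ {x y} → x ∧ y ≡ true → x ≡ true × y ≡ true
∧-elim {true} {true} _ = refl , refl

true-and-false : ∀ {x} → x ≡ true → x ≡ false → ⊥
true-and-false refl ()

≡ᵇ-true⇒≡ : ∀ {m n} → (m ≡ᵇ n) ≡ true → m ≡ n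
≡ᵇ-true⇒≡ {m} {n} e = ≡ᵇ⇒≡ m n (Equivalence.from T-≡ e)

≡⇒≡ᵇ-true : ∀ {m n} → m ≡ n → (m ≡ᵇ n) ≡ true
≡⇒≡ᵇ-true {m} {n} e = Equivalence.to T-≡ (≡⇒≡ᵇ m n e)

≡ᵇ-sym : ∀ m n → (m ≡ᵇ n) ≡ (n ≡ᵇ m)
≡ᵇ-sym zero    zero    = refl
≡ᵇ-sym zero    (suc n) = refl
≡ᵇ-sym (suc m) zero    = refl
≡ᵇ-sym (suc m) (suc n) = ≡ᵇ-sym m n

∈⇒lookup : ∀ {m} {x : Fin m} {p : Subset m} → x ∈ p → lookup p x ≡ true
∈⇒lookup = []=⇒lookup

lookup⇒∈ : ∀ {m} {x : Fin m} {p : Subset m} → lookup p x ≡ true → x ∈ p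
lookup⇒∈ {x = x} {p} = lookup⇒[]= x p

next-index : ∀ {ℓ} (t : Fin ℓ) → suc (toℕ t) ≢ ℓ → ∃[ t′ ] (toℕ t′ ≡ suc (toℕ t))
next-index {ℓ} t not-last = fromℕ< t+1<ℓ , toℕ-fromℕ< t+1<ℓ
  where
  t+1<ℓ : suc (toℕ t) < ℓ
  t+1<ℓ = ≤∧≢⇒< (toℕ<n t) not-last

below-not-last : ∀ {ℓ} (i j : Fin ℓ) → toℕ i < toℕ j → suc (toℕ i) ≢ ℓ
below-not-last i j i<j i+1≡ℓ = 1+n≰n (≤-trans (toℕ<n j) (≤-trans (≤-reflexive (sym i+1≡ℓ)) i<j))

module _ {m} {G : Adj m} {S : Subset m} where

  walk-head : ∀ {u v} → WalkIn G S u v → u ∈ S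
  walk-head (stop u∈S)     = u∈S
  walk-head (step u∈S _ _) = u∈S

  infixr 5 _++ʷ_
  _++ʷ_ : ∀ {u v w} → WalkIn G S u v → WalkIn G S v w → WalkIn G S u w
  stop _       ++ʷ q = q
  step u∈S e p ++ʷ q = step u∈S e (p ++ʷ q)

  edge-walk : ∀ {u v} → u ∈ S → v ∈ S → G u v ≡ true → WalkIn G S u v
  edge-walk u∈S v∈S e = step u∈S e (stop v∈S)

  reverse-walk : (∀ a b → G a b ≡ G b a) → ∀ {u v} → WalkIn G S u v → WalkIn G S v u
  reverse-walk sym-G (stop u∈S) = stop u∈S
  reverse-walk sym-G (step {u} {v} u∈S e p) =
    reverse-walk sym-G p ++ʷ edge-walk (walk-head p) u∈S (trans (sym-G v u) e)

  walk-mono : ∀ {S′} → (∀ {x} → x ∈ S → x ∈ S′) → ∀ {u v} → WalkIn G S u v → WalkIn G S′ u v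
  walk-mono S⊆S′ (stop u∈S)     = stop (S⊆S′ u∈S)
  walk-mono S⊆S′ (step u∈S e p) = step (S⊆S′ u∈S) e (walk-mono S⊆S′ p)

walk-map : ∀ {m m′} {G : Adj m} {G′ : Adj m′} {S S′} (f : Fin m → Fin m′) →
  (∀ {a} → a ∈ S → f a ∈ S′) →
  (∀ {a b} → a ∈ S → b ∈ S → G a b ≡ true → WalkIn G′ S′ (f a) (f b)) →
  ∀ {u v} → WalkIn G S u v → WalkIn G′ S′ (f u) (f v)
walk-map f f∈ f-edge (stop u∈S)     = stop (f∈ u∈S)
walk-map f f∈ f-edge (step u∈S e p) = f-edge u∈S (walk-head p) e ++ʷ walk-map f f∈ f-edge p

walk-by-descent : ∀ {m} {G : Adj m} {S : Subset m} {c} (μ : Fin m → ℕ) →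
  (∀ {a} → a ∈ S → WalkIn G S a c ⊎ ∃[ b ] (b ∈ S × G a b ≡ true × μ b < μ a)) →
  ∀ {a} → a ∈ S → WalkIn G S a c
walk-by-descent {G = G} {S} {c} μ done-or-descend {a} = go (suc (μ a)) ≤-refl
  where
  go : ∀ fuel {a} → μ a < fuel → a ∈ S → WalkIn G S a c
  go (suc fuel) μa<fuel a∈S with done-or-descend a∈S
  ... | inj₁ walk = walk
  ... | inj₂ (b , b∈S , e , μb<μa) = step a∈S e (go fuel (<-≤-trans μb<μa (≤-pred μa<fuel)) b∈S)

connected-via-hub : ∀ {m} {G : Adj m} {S : Subset m} {c} → (∀ a b → G a b ≡ G b a) →
  (∀ {a} → a ∈ S → WalkIn G S a c) → InducesConnected G S
connected-via-hub sym-G to-hub u v u∈S v∈S = to-hub u∈S ++ʷ reverse-walk sym-G (to-hub v∈S)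

walk-visits-level : ∀ {m} {G : Adj m} {S : Subset m} (f : Fin m → ℕ) →
  (∀ {a b} → G a b ≡ true → f b ≤ suc (f a)) →
  ∀ {a b} → WalkIn G S a b → ∀ s → f a ≤ s → s ≤ f b → ∃[ c ] (c ∈ S × f c ≡ s)
walk-visits-level f slow (stop a∈S) s fa≤s s≤fb = _ , a∈S , ≤-antisym fa≤s s≤fb
walk-visits-level f slow (step {a} a∈S e p) s fa≤s s≤fb with f a ≟ℕ s
... | yes fa≡s = a , a∈S , fa≡s
... | no fa≢s  = walk-visits-level f slow p s (≤-trans (slow e) (≤∧≢⇒< fa≤s fa≢s)) s≤fb

indicator : Bool → ℕ
indicator true  = 1
indicator false = 0

∣∷∣ : ∀ {m} b (S : Subset m) → ∣ b ∷ S ∣ ≡ indicator b + ∣ S ∣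
∣∷∣ true  S = refl
∣∷∣ false S = refl

count : ∀ {m} → (Fin m → Bool) → ℕ
count f = ∣ tabulate f ∣

count-cong : ∀ {m} {f g : Fin m → Bool} → (∀ i → f i ≡ g i) → count f ≡ count g
count-cong f≗g = cong ∣_∣ (tabulate-cong f≗g)

count-lookup : ∀ {m} (S : Subset m) → count (lookup S) ≡ ∣ S ∣
count-lookup S = cong ∣_∣ (tabulate∘lookup S)

count-suc : ∀ {m} (f : Fin (suc m) → Bool) → count f ≡ indicator (f zero) + count (f ∘ suc)
count-suc f = ∣∷∣ (f zero) (tabulate (f ∘ suc))

count-↑ : ∀ m k (f : Fin (m + k) → Bool) →
  count f ≡ count (λ i → f (i ↑ˡ k)) + count (λ j → f (m ↑ʳ j))
count-↑ zero    k f = refl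
count-↑ (suc m) k f = begin
  count f
    ≡⟨ count-suc f ⟩
  indicator (f zero) + count (f ∘ suc)
    ≡⟨ cong (indicator (f zero) +_) (count-↑ m k (f ∘ suc)) ⟩
  indicator (f zero) + (count left + count right)
    ≡⟨ +-assoc (indicator (f zero)) _ _ ⟨
  (indicator (f zero) + count left) + count right
    ≡⟨ cong (_+ count right) (count-suc (λ i → f (i ↑ˡ k))) ⟨
  count (λ i → f (i ↑ˡ k)) + count (λ j → f (suc m ↑ʳ j)) ∎
  where
  open ≡-Reasoning
  left : Fin m → Bool
  left i = f (suc (i ↑ˡ k))
  right : Fin k → Bool
  right j = f (suc m ↑ʳ j)

count-≥1 : ∀ {m} (f : Fin m → Bool) i → f i ≡ true → 1 ≤ count f
count-≥1 f zero    e rewrite e = s≤s z≤n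
count-≥1 f (suc i) e = ≤-trans (count-≥1 (f ∘ suc) i e) (∣p∣≤∣x∷p∣ (f zero) (tabulate (f ∘ suc)))

count-true : ∀ ℓ → count {ℓ} (λ _ → true) ≡ ℓ
count-true zero    = refl
count-true (suc ℓ) = cong suc (count-true ℓ)

count-all-but-one : ∀ {ℓ} (s : Fin ℓ) → suc (count (λ t → not (does (t ≟ s)))) ≡ ℓ
count-all-but-one {suc ℓ} zero    = cong suc (count-true ℓ)
count-all-but-one {suc ℓ} (suc s) = cong suc (count-all-but-one s)

remove : ∀ {m} → Subset m → Fin m → Subset m
remove S u = S [ u ]≔ false

∣remove∣ : ∀ {m} (S : Subset m) {u} → u ∈ S → suc ∣ remove S u ∣ ≡ ∣ S ∣
∣remove∣ (true ∷ S) here = refl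
∣remove∣ (b ∷ S) {suc u} (there u∈S) rewrite ∣∷∣ b (remove S u) | ∣∷∣ b S =
  trans (sym (+-suc (indicator b) _)) (cong (indicator b +_) (∣remove∣ S u∈S))

module _ {m} {S : Subset m} {u : Fin m} where

  ∈-remove : ∀ {x} → x ∈ S → x ≢ u → x ∈ remove S u
  ∈-remove {x} x∈S x≢u = lookup⇒∈ (trans (lookup∘update′ x≢u S false) (∈⇒lookup x∈S))

  ∉-remove : u ∉ remove S u
  ∉-remove u∈ with trans (sym (lookup∘update u S false)) (∈⇒lookup u∈)
  ... | ()

  remove-⊆ : ∀ {x} → x ∈ remove S u → x ∈ S
  remove-⊆ {x} x∈ with x ≟ u
  ... | yes refl = ⊥-elim (∉-remove x∈)
  ... | no x≢u   = lookup⇒∈ (trans (sym (lookup∘update′ x≢u S false)) (∈⇒lookup x∈))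

walk-after-last : ∀ {m} {G : Adj m} {S} u {a w} → w ≢ u → WalkIn G S a w →
  WalkIn G (remove S u) a w ⊎ ∃[ x ] (G u x ≡ true × WalkIn G (remove S u) x w)
walk-after-last u w≢u (stop w∈S) = inj₁ (stop (∈-remove w∈S w≢u))
walk-after-last u w≢u (step {a} {v} a∈S e p) with walk-after-last u w≢u p
... | inj₂ r = inj₂ r
... | inj₁ q with a ≟ u
...   | yes refl = inj₂ (v , e , q)
...   | no a≢u   = inj₁ (step (∈-remove a∈S a≢u) e q)

-- Recursion on ∣ S ∣: after its last visit to u, a walk from u to w ≠ u stays inside S − u.
walk? : ∀ {m} (G : Adj m) f (S : Subset m) → ∣ S ∣ ≡ f → ∀ u w → Dec (WalkIn G S u w)
walk? G f S ∣S∣≡f u w with u ∈? S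
... | no u∉S = no (u∉S ∘ walk-head)
... | yes u∈S with u ≟ w
...   | yes refl = yes (stop u∈S)
walk? G zero S ∣S∣≡f u w | yes u∈S | no _ with trans (∣remove∣ S u∈S) ∣S∣≡f
... | ()
walk? G (suc f) S ∣S∣≡f u w | yes u∈S | no u≢w
  with any? (λ x → (G u x ≟ᵇ true) ×-dec
                   walk? G f (remove S u) (suc-injective (trans (∣remove∣ S u∈S) ∣S∣≡f)) x w)
... | yes (x , e , p) = yes (step u∈S e (walk-mono remove-⊆ p))
... | no ¬next = no λ p →
  [ ∉-remove ∘ walk-head , ¬next ]′ (walk-after-last u (u≢w ∘ sym) p)

isCDS? : ∀ {m} (G : Adj m) (S : Subset m) → Dec (IsCDS G S)
isCDS? G S =
  all? (λ v → (v ∈? S) ⊎-dec any? (λ u → (u ∈? S) ×-dec (G u v ≟ᵇ true)))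
  ×-dec all? (λ u → all? (λ v → (u ∈? S) →-dec ((v ∈? S) →-dec walk? G _ S refl u v)))

minimum-exists : ∀ {m} (P : Subset m → Set) → (∀ S → Dec (P S)) → ∀ b → (∃[ S ] (P S × ∣ S ∣ ≤ b)) →
  ∃[ k ] ((∃[ S ] (P S × ∣ S ∣ ≡ k)) × (∀ S → P S → k ≤ ∣ S ∣))
minimum-exists P P? zero (S , pS , ∣S∣≤0) = 0 , (S , pS , n≤0⇒n≡0 ∣S∣≤0) , (λ _ _ → z≤n)
minimum-exists P P? (suc b) (S , pS , ∣S∣≤1+b) with anySubset? (λ S → P? S ×-dec (∣ S ∣ ≤? b))
... | yes smaller = minimum-exists P P? b smaller
... | no ¬smaller =
  ∣ S ∣ , (S , pS , refl) , λ S′ pS′ → ≤-trans ∣S∣≤1+b (≰⇒> (λ ∣S′∣≤b → ¬smaller (S′ , pS′ , ∣S′∣≤b)))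

γc-exists : ∀ {m} (G : Adj m) (S : Subset m) → IsCDS G S → ∃[ k ] (GammaC≡ G k × k ≤ ∣ S ∣)
γc-exists G S cds with minimum-exists (IsCDS G) (isCDS? G) ∣ S ∣ (S , cds , ≤-refl)
... | k , attained , minimal = k , (attained , minimal) , minimal S cds

cds⇒connected : ∀ {m} (G : Adj m) → (∀ a b → G a b ≡ G b a) → ∀ {D} → IsCDS G D → Fin m → Connected G
cds⇒connected G sym-G {D} (dom , conn) v =
  v , connected-via-hub sym-G (λ {u} _ → walk-to (proj₂ member) u)
  where
  member : ∃[ c ] (c ∈ D)
  member with dom v
  ... | inj₁ v∈D           = v , v∈D
  ... | inj₂ (c , c∈D , _) = c , c∈D
  walk-to : ∀ {c} → c ∈ D → ∀ u → WalkIn G ⊤ u c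
  walk-to {c} c∈D u with dom u
  ... | inj₁ u∈D = walk-mono (λ _ → ∈⊤) (conn u c u∈D c∈D)
  ... | inj₂ (d , d∈D , e) = step ∈⊤ (trans (sym-G u d) e) (walk-mono (λ _ → ∈⊤) (conn d c d∈D c∈D))

dominating-vertex-isCDS : ∀ {m} (G : Adj m) w → (∀ v → v ≢ w → G w v ≡ true) → IsCDS G ⁅ w ⁆
dominating-vertex-isCDS G w adjacent = dom , conn
  where
  dom : Dominating G ⁅ w ⁆
  dom v with v ≟ w
  ... | yes refl = inj₁ (x∈⁅x⁆ w)
  ... | no v≢w   = inj₂ (w , x∈⁅x⁆ w , adjacent v v≢w)
  conn : InducesConnected G ⁅ w ⁆
  conn u v u∈ v∈ rewrite x∈⁅y⁆⇒x≡y w u∈ | x∈⁅y⁆⇒x≡y w v∈ = stop (x∈⁅x⁆ w)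

module _ {m} (G : Adj m) (a b : Fin m) where

  addEdge-⊇ : ∀ x y → G x y ≡ true → addEdge G a b x y ≡ true
  addEdge-⊇ x y = ∨-introˡ _

  addEdge-joins : addEdge G a b a b ≡ true
  addEdge-joins = ∨-introʳ (G a b) (∨-introˡ _ (cong₂ _∧_ (is-yes-refl a) (is-yes-refl b)))
    where
    is-yes-refl : ∀ x → ⌊ x ≟ x ⌋ ≡ true
    is-yes-refl x with x ≟ x
    ... | yes _  = refl
    ... | no x≢x = ⊥-elim (x≢x refl)

  addEdge-sym : (∀ x y → G x y ≡ G y x) → ∀ x y → addEdge G a b x y ≡ addEdge G a b y x
  addEdge-sym sym-G x y = cong₂ _∨_ (sym-G x y)
    (trans (∨-comm (⌊ x ≟ a ⌋ ∧ ⌊ y ≟ b ⌋) (⌊ x ≟ b ⌋ ∧ ⌊ y ≟ a ⌋))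
           (cong₂ _∨_ (∧-comm ⌊ x ≟ b ⌋ ⌊ y ≟ a ⌋) (∧-comm ⌊ x ≟ a ⌋ ⌊ y ≟ b ⌋)))

  private
    is-yes⇒≡ : ∀ {c d : Fin m} → ⌊ c ≟ d ⌋ ≡ true → c ≡ d
    is-yes⇒≡ {c} {d} e with c ≟ d
    ... | yes c≡d = c≡d

    both : ∀ {c d c′ d′ : Fin m} → ⌊ c ≟ d ⌋ ∧ ⌊ c′ ≟ d′ ⌋ ≡ true → c ≡ d × c′ ≡ d′
    both e with ∧-elim e
    ... | e₁ , e₂ = is-yes⇒≡ e₁ , is-yes⇒≡ e₂

  addEdge-cases : ∀ x y → addEdge G a b x y ≡ true →
    G x y ≡ true ⊎ (x ≡ a × y ≡ b) ⊎ (x ≡ b × y ≡ a)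
  addEdge-cases x y e with ∨-elim {G x y} e
  ... | inj₁ present = inj₁ present
  ... | inj₂ new with ∨-elim {⌊ x ≟ a ⌋ ∧ ⌊ y ≟ b ⌋} new
  ...   | inj₁ ab = inj₂ (inj₁ (both ab))
  ...   | inj₂ ba = inj₂ (inj₂ (both ba))

Offsets : ∀ {ℓ} → Vec ℕ ℓ → Set
Offsets {ℓ} ns = (t : Fin ℓ) → Fin (lookup ns t)

blockVertex : ∀ {ℓ} (ns : Vec ℕ ℓ) (t : Fin ℓ) → Fin (lookup ns t) → Fin (sum ns)
blockVertex (m ∷ ns) zero    o = o ↑ˡ sum ns
blockVertex (m ∷ ns) (suc t) o = m ↑ʳ blockVertex ns t o

blockOf-blockVertex : ∀ {ℓ} (ns : Vec ℕ ℓ) t o → blockOf ns (blockVertex ns t o) ≡ t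
blockOf-blockVertex (m ∷ ns) zero    o rewrite splitAt-↑ˡ m o (sum ns) = refl
blockOf-blockVertex (m ∷ ns) (suc t) o rewrite splitAt-↑ʳ m (sum ns) (blockVertex ns t o) =
  cong suc (blockOf-blockVertex ns t o)

blockVertex-surjective : ∀ {ℓ} (ns : Vec ℕ ℓ) b → ∃[ t ] ∃[ o ] (blockVertex ns t o ≡ b)
blockVertex-surjective (m ∷ ns) b with splitAt m b in eq
... | inj₁ o = zero , o , splitAt⁻¹-↑ˡ eq
... | inj₂ b′ with blockVertex-surjective ns b′
...   | t , o , refl = suc t , o , splitAt⁻¹-↑ʳ eq

blockVertex-injective : ∀ {ℓ} (ns : Vec ℕ ℓ) t {o o′} → blockVertex ns t o ≡ blockVertex ns t o′ → o ≡ o′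
blockVertex-injective (m ∷ ns) zero    e = ↑ˡ-injective (sum ns) _ _ e
blockVertex-injective (m ∷ ns) (suc t) e = blockVertex-injective ns t (↑ʳ-injective m _ _ e)

singletonIf : ∀ {m} → Bool → Fin m → Subset m
singletonIf true  c = ⁅ c ⁆
singletonIf false c = ∅

∣singletonIf∣ : ∀ {m} b (c : Fin m) → ∣ singletonIf b c ∣ ≡ indicator b
∣singletonIf∣ true  c = ∣⁅x⁆∣≡1 c
∣singletonIf∣ {m} false c = ∣⊥∣≡0 m

∈-singletonIf : ∀ {m} b (c o : Fin m) → lookup (singletonIf b c) o ≡ true → b ≡ true × o ≡ c
∈-singletonIf true  c o e = refl , x∈⁅y⁆⇒x≡y c (lookup⇒∈ e)
∈-singletonIf {m} false c o e = ⊥-elim (∉⊥ (lookup⇒∈ {p = ∅ {m}} e))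

-- The characteristic function of {vertex off t of block t ∣ P t} ⊆ Fin (sum ns).
chosen : ∀ {ℓ} (ns : Vec ℕ ℓ) → (Fin ℓ → Bool) → Offsets ns → Fin (sum ns) → Bool
chosen (m ∷ ns) P off b with splitAt m b
... | inj₁ o  = lookup (singletonIf (P zero) (off zero)) o
... | inj₂ b′ = chosen ns (P ∘ suc) (off ∘ suc) b′

chosen-blockVertex : ∀ {ℓ} (ns : Vec ℕ ℓ) P off t o →
  chosen ns P off (blockVertex ns t o) ≡ lookup (singletonIf (P t) (off t)) o
chosen-blockVertex (m ∷ ns) P off zero    o rewrite splitAt-↑ˡ m o (sum ns) = refl
chosen-blockVertex (m ∷ ns) P off (suc t) o rewrite splitAt-↑ʳ m (sum ns) (blockVertex ns t o) =
  chosen-blockVertex ns (P ∘ suc) (off ∘ suc) t o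

count-chosen : ∀ {ℓ} (ns : Vec ℕ ℓ) P off → count (chosen ns P off) ≡ count P
count-chosen []       P off = refl
count-chosen (m ∷ ns) P off = begin
  count (chosen (m ∷ ns) P off)
    ≡⟨ count-↑ m (sum ns) (chosen (m ∷ ns) P off) ⟩
  count (λ o → chosen (m ∷ ns) P off (o ↑ˡ sum ns)) + count (λ b → chosen (m ∷ ns) P off (m ↑ʳ b))
    ≡⟨ cong₂ _+_ (count-cong (chosen-blockVertex (m ∷ ns) P off zero)) (count-cong rest) ⟩
  count (lookup (singletonIf (P zero) (off zero))) + count (chosen ns (P ∘ suc) (off ∘ suc))
    ≡⟨ cong₂ _+_ (trans (count-lookup (singletonIf (P zero) (off zero))) (∣singletonIf∣ (P zero) (off zero)))
                 (count-chosen ns (P ∘ suc) (off ∘ suc)) ⟩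
  indicator (P zero) + count (P ∘ suc)
    ≡⟨ count-suc P ⟨
  count P ∎
  where
  open ≡-Reasoning
  rest : ∀ b → chosen (m ∷ ns) P off (m ↑ʳ b) ≡ chosen ns (P ∘ suc) (off ∘ suc) b
  rest b rewrite splitAt-↑ʳ m (sum ns) b = refl

count-≥-blocks : ∀ {ℓ} (ns : Vec ℕ ℓ) (g : Fin (sum ns) → Bool) →
  (∀ t → ∃[ o ] (g (blockVertex ns t o) ≡ true)) → ℓ ≤ count g
count-≥-blocks []       g hits = z≤n
count-≥-blocks (m ∷ ns) g hits = begin
  suc _
    ≤⟨ +-mono-≤ (count-≥1 (λ o → g (o ↑ˡ sum ns)) (proj₁ (hits zero)) (proj₂ (hits zero)))
                (count-≥-blocks ns (λ b → g (m ↑ʳ b)) (hits ∘ suc)) ⟩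
  count (λ o → g (o ↑ˡ sum ns)) + count (λ b → g (m ↑ʳ b))
    ≡⟨ count-↑ m (sum ns) g ⟨
  count g ∎
  where open ≤-Reasoning

module Construction {ℓ n : ℕ} (G : Adj n) (H : Subset n) (ns : Vec ℕ ℓ) (simple : IsSimple G) where

  N : ℕ
  N = suc (sum ns + n)

  G⋆ : Adj N
  G⋆ = Gstar G H ns

  X₀ : Fin N
  X₀ = zero

  B : (t : Fin ℓ) → Fin (lookup ns t) → Fin N
  B t o = suc (blockVertex ns t o ↑ˡ n)

  O : Fin n → Fin N
  O v = suc (sum ns ↑ʳ v)

  kind-B : ∀ t o → kind {ℓ} {n} ns (B t o) ≡ blk t
  kind-B t o rewrite splitAt-↑ˡ (sum ns) (blockVertex ns t o) n = cong blk (blockOf-blockVertex ns t o)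

  kind-O : ∀ v → kind {ℓ} {n} ns (O v) ≡ old v
  kind-O v rewrite splitAt-↑ʳ (sum ns) n v = refl

  data View : Fin N → Set where
    x₀ᵛ    : View X₀
    blockᵛ : ∀ t o → View (B t o)
    oldᵛ   : ∀ v → View (O v)

  view : ∀ a → View a
  view zero = x₀ᵛ
  view (suc y) with splitAt (sum ns) y in eq
  ... | inj₂ v = subst View (cong suc (splitAt⁻¹-↑ʳ eq)) (oldᵛ v)
  ... | inj₁ b with blockVertex-surjective ns b
  ...   | t , o , refl = subst View (cong suc (splitAt⁻¹-↑ˡ eq)) (blockᵛ t o)

  O-injective : ∀ {u v} → O u ≡ O v → u ≡ v
  O-injective e = ↑ʳ-injective (sum ns) _ _ (Fin-suc-injective e)

  B-injective : ∀ {t o o′} → B t o ≡ B t o′ → o ≡ o′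
  B-injective {t} e = blockVertex-injective ns t (↑ˡ-injective n _ _ (Fin-suc-injective e))

  B-block : ∀ {t t′ o o′} → B t o ≡ B t′ o′ → t ≡ t′
  B-block {t} {t′} {o} {o′} e with trans (sym (kind-B t o)) (trans (cong (kind ns) e) (kind-B t′ o′))
  ... | refl = refl

  B≢O : ∀ {t o v} → B t o ≢ O v
  B≢O {t} {o} {v} e with trans (sym (kind-B t o)) (trans (cong (kind ns) e) (kind-O v))
  ... | ()

  B≢X₀ : ∀ {t o} → B t o ≢ X₀
  B≢X₀ ()

  O≢X₀ : ∀ {v} → O v ≢ X₀
  O≢X₀ ()

  G⋆-distinct : ∀ {a b κ κ′} → a ≢ b → kind ns a ≡ κ → kind ns b ≡ κ′ → G⋆ a b ≡ kindAdj G H κ κ′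
  G⋆-distinct {a} {b} a≢b refl refl with a ≟ b
  ... | yes a≡b = ⊥-elim (a≢b a≡b)
  ... | no _    = refl

  G⋆-loopless : ∀ a → G⋆ a a ≡ false
  G⋆-loopless a with a ≟ a
  ... | yes _  = refl
  ... | no a≢a = ⊥-elim (a≢a refl)

  G⋆-edge⇒≢ : ∀ {a b} → G⋆ a b ≡ true → a ≢ b
  G⋆-edge⇒≢ {a} e refl with trans (sym e) (G⋆-loopless a)
  ... | ()

  G⋆-edge⇒kindAdj : ∀ {a b} → G⋆ a b ≡ true → kindAdj G H (kind ns a) (kind ns b) ≡ true
  G⋆-edge⇒kindAdj {a} {b} e = trans (sym (G⋆-distinct {a} {b} (G⋆-edge⇒≢ e) refl refl)) e

  kindAdj-sym : ∀ κ κ′ → kindAdj {ℓ} G H κ κ′ ≡ kindAdj G H κ′ κ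
  kindAdj-sym x₀      x₀      = refl
  kindAdj-sym x₀      (blk i) = refl
  kindAdj-sym x₀      (old v) = refl
  kindAdj-sym (blk i) x₀      = refl
  kindAdj-sym (blk i) (blk j) =
    cong₂ _∨_ (≡ᵇ-sym (toℕ i) (toℕ j)) (∨-comm (suc (toℕ i) ≡ᵇ toℕ j) (suc (toℕ j) ≡ᵇ toℕ i))
  kindAdj-sym (blk i) (old v) = refl
  kindAdj-sym (old v) x₀      = refl
  kindAdj-sym (old v) (blk i) = refl
  kindAdj-sym (old u) (old v) = proj₁ simple u v

  G⋆-sym : ∀ a b → G⋆ a b ≡ G⋆ b a
  G⋆-sym a b = by-cases (a ≟ b)
    where
    by-cases : Dec (a ≡ b) → G⋆ a b ≡ G⋆ b a
    by-cases (yes refl) = refl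
    by-cases (no a≢b)   = trans (G⋆-distinct a≢b refl refl)
      (trans (kindAdj-sym (kind ns a) (kind ns b)) (sym (G⋆-distinct (a≢b ∘ sym) refl refl)))

  G⋆-flip : ∀ a b → G⋆ a b ≡ true → G⋆ b a ≡ true
  G⋆-flip a b e = trans (G⋆-sym b a) e

  O-O-adj : ∀ u v → G⋆ (O u) (O v) ≡ G u v
  O-O-adj u v with u ≟ v
  ... | yes refl = trans (G⋆-loopless (O u)) (sym (proj₂ simple u))
  ... | no u≢v   = G⋆-distinct (u≢v ∘ O-injective) (kind-O u) (kind-O v)

  first-B-X₀-adj : ∀ t o → toℕ t ≡ 0 → G⋆ (B t o) X₀ ≡ true
  first-B-X₀-adj t o t≡0 = trans (G⋆-distinct B≢X₀ (kind-B t o) refl) (≡⇒≡ᵇ-true t≡0)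

  next-B-B-adj : ∀ t o t′ o′ → toℕ t′ ≡ suc (toℕ t) → G⋆ (B t o) (B t′ o′) ≡ true
  next-B-B-adj t o t′ o′ e =
    trans (G⋆-distinct (λ b≡ → 1+n≢n (trans (sym e) (cong toℕ (sym (B-block b≡))))) (kind-B t o) (kind-B t′ o′))
          (∨-introʳ (toℕ t ≡ᵇ toℕ t′) (∨-introˡ (suc (toℕ t′) ≡ᵇ toℕ t) (≡⇒≡ᵇ-true (sym e))))

  same-B-B-adj : ∀ t {o o′} → o ≢ o′ → G⋆ (B t o) (B t o′) ≡ true
  same-B-B-adj t {o} {o′} o≢o′ =
    trans (G⋆-distinct (o≢o′ ∘ B-injective) (kind-B t o) (kind-B t o′))
          (∨-introˡ ((suc (toℕ t) ≡ᵇ toℕ t) ∨ (suc (toℕ t) ≡ᵇ toℕ t)) (≡⇒≡ᵇ-true {toℕ t} refl))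

  last-B-H-adj : ∀ t o h → suc (toℕ t) ≡ ℓ → h ∈ H → G⋆ (B t o) (O h) ≡ true
  last-B-H-adj t o h last h∈H =
    trans (G⋆-distinct B≢O (kind-B t o) (kind-O h)) (cong₂ _∧_ (≡⇒≡ᵇ-true last) (∈⇒lookup h∈H))

  nonadjacent-blocks-far : ∀ t o t′ o′ → B t o ≢ B t′ o′ → G⋆ (B t o) (B t′ o′) ≡ false →
    2 + toℕ t ≤ toℕ t′ ⊎ 2 + toℕ t′ ≤ toℕ t
  nonadjacent-blocks-far t o t′ o′ B≢B nonadj with <-cmp (toℕ t) (toℕ t′)
  ... | tri≈ _ t≡t′ _ with toℕ-injective t≡t′
  ...   | refl with o ≟ o′
  ...     | yes refl = ⊥-elim (B≢B refl)
  ...     | no o≢o′  = ⊥-elim (true-and-false (same-B-B-adj t o≢o′) nonadj)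
  nonadjacent-blocks-far t o t′ o′ B≢B nonadj | tri< t<t′ _ _ with suc (toℕ t) ≟ℕ toℕ t′
  ... | yes next    = ⊥-elim (true-and-false (next-B-B-adj t o t′ o′ (sym next)) nonadj)
  ... | no not-next = inj₁ (≤∧≢⇒< t<t′ not-next)
  nonadjacent-blocks-far t o t′ o′ B≢B nonadj | tri> _ _ t′<t with suc (toℕ t′) ≟ℕ toℕ t
  ... | yes next    =
    ⊥-elim (true-and-false (G⋆-flip (B t′ o′) (B t o) (next-B-B-adj t′ o′ t o (sym next))) nonadj)
  ... | no not-next = inj₂ (≤∧≢⇒< t′<t not-next)

  X₀-neighbour : ∀ {a} → View a → G⋆ a X₀ ≡ true → ∃[ t ] ∃[ o ] (a ≡ B t o × toℕ t ≡ 0)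
  X₀-neighbour x₀ᵛ         e with trans (sym e) (G⋆-loopless X₀)
  ... | ()
  X₀-neighbour (blockᵛ t o) e = t , o , refl , ≡ᵇ-true⇒≡ (trans (sym (G⋆-distinct B≢X₀ (kind-B t o) refl)) e)
  X₀-neighbour (oldᵛ v)     e with trans (sym e) (G⋆-distinct O≢X₀ (kind-O v) refl)
  ... | ()

  O-neighbour : ∀ {a} → View a → ∀ w → G⋆ a (O w) ≡ true →
    ∃[ u ] (a ≡ O u × G u w ≡ true) ⊎ ∃[ t ] ∃[ o ] (a ≡ B t o × suc (toℕ t) ≡ ℓ × w ∈ H)
  O-neighbour x₀ᵛ          w e with trans (sym e) (G⋆-distinct (O≢X₀ ∘ sym) refl (kind-O w))
  ... | ()
  O-neighbour (oldᵛ u)     w e = inj₁ (u , refl , trans (sym (O-O-adj u w)) e)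
  O-neighbour (blockᵛ t o) w e with ∧-elim (trans (sym (G⋆-distinct B≢O (kind-B t o) (kind-O w))) e)
  ... | last , w∈H = inj₂ (t , o , refl , ≡ᵇ-true⇒≡ last , lookup⇒∈ w∈H)

  B-O-adj⇒H : ∀ {t o x} → G⋆ (B t o) (O x) ≡ true → x ∈ H
  B-O-adj⇒H {t} {o} {x} e with O-neighbour (blockᵛ t o) x e
  ... | inj₁ (_ , B≡O , _)         = ⊥-elim (B≢O B≡O)
  ... | inj₂ (_ , _ , _ , _ , x∈H) = x∈H

  X₀-O-nonadj : ∀ {x} → G⋆ X₀ (O x) ≡ true → ⊥
  X₀-O-nonadj {x} e with O-neighbour x₀ᵛ x e
  ... | inj₁ (_ , X₀≡O , _)         = O≢X₀ (sym X₀≡O)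
  ... | inj₂ (_ , _ , X₀≡B , _ , _) = B≢X₀ (sym X₀≡B)

  levelᴷ : Kind ℓ n → ℕ
  levelᴷ x₀      = 0
  levelᴷ (blk i) = suc (toℕ i)
  levelᴷ (old v) = suc ℓ

  level : Fin N → ℕ
  level a = levelᴷ (kind ns a)

  level-B : ∀ t o → level (B t o) ≡ suc (toℕ t)
  level-B t o = cong levelᴷ (kind-B t o)

  level-O : ∀ v → level (O v) ≡ suc ℓ
  level-O v = cong levelᴷ (kind-O v)

  level-O≰ℓ : ∀ v → level (O v) ≤ ℓ → ⊥
  level-O≰ℓ v le = 1+n≰n (≤-trans (≤-reflexive (sym (level-O v))) le)

  kindAdj-level : ∀ κ κ′ → kindAdj {ℓ} G H κ κ′ ≡ true → levelᴷ κ ≤ suc (levelᴷ κ′)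
  kindAdj-level x₀      κ′      e = z≤n
  kindAdj-level (blk i) x₀      e = s≤s (≤-reflexive (≡ᵇ-true⇒≡ e))
  kindAdj-level (blk i) (blk j) e with ∨-elim {toℕ i ≡ᵇ toℕ j} e
  ... | inj₁ same = ≤-trans (s≤s (≤-reflexive (≡ᵇ-true⇒≡ same))) (n≤1+n _)
  ... | inj₂ next with ∨-elim {suc (toℕ i) ≡ᵇ toℕ j} next
  ...   | inj₁ up   = ≤-trans (≤-reflexive (≡ᵇ-true⇒≡ up)) (≤-trans (n≤1+n _) (n≤1+n _))
  ...   | inj₂ down = s≤s (≤-reflexive (sym (≡ᵇ-true⇒≡ down)))
  kindAdj-level (blk i) (old v) e = ≤-trans (toℕ<n i) (≤-trans (n≤1+n ℓ) (n≤1+n _))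
  kindAdj-level (old v) (blk i) e = s≤s (≤-reflexive (sym (≡ᵇ-true⇒≡ (proj₁ (∧-elim e)))))
  kindAdj-level (old u) (old v) e = n≤1+n _

  level-edge : ∀ {a b} → G⋆ a b ≡ true → level b ≤ suc (level a)
  level-edge {a} {b} e = kindAdj-level (kind ns b) (kind ns a) (G⋆-edge⇒kindAdj {b} {a} (G⋆-flip a b e))

  setOffset : Offsets ns → (i : Fin ℓ) → Fin (lookup ns i) → Offsets ns
  setOffset off i o t with t ≟ i
  ... | yes refl = o
  ... | no _     = off t

  setOffset-same : ∀ (off : Offsets ns) i o → setOffset off i o i ≡ o
  setOffset-same off i o with i ≟ i
  ... | yes refl = refl
  ... | no i≢i   = ⊥-elim (i≢i refl)

  setOffset-other : ∀ (off : Offsets ns) i o {t} → t ≢ i → setOffset off i o t ≡ off t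
  setOffset-other off i o {t} t≢i with t ≟ i
  ... | yes t≡i = ⊥-elim (t≢i t≡i)
  ... | no _    = refl

  -- T ∪ {vertex off t of block t ∣ P t}.
  extendᶜ : Subset n → (Fin ℓ → Bool) → Offsets ns → Fin N → Bool
  extendᶜ T P off zero = false
  extendᶜ T P off (suc y) with splitAt (sum ns) y
  ... | inj₁ b = chosen ns P off b
  ... | inj₂ v = lookup T v

  extend : Subset n → (Fin ℓ → Bool) → Offsets ns → Subset N
  extend T P off = tabulate (extendᶜ T P off)

  module _ {T : Subset n} {P : Fin ℓ → Bool} {off : Offsets ns} where

    private
      ∈-extend⇒ : ∀ {a} → a ∈ extend T P off → extendᶜ T P off a ≡ true
      ∈-extend⇒ {a} a∈ = trans (sym (lookup∘tabulate (extendᶜ T P off) a)) (∈⇒lookup a∈)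

      ⇒∈-extend : ∀ {a} → extendᶜ T P off a ≡ true → a ∈ extend T P off
      ⇒∈-extend {a} e = lookup⇒∈ (trans (lookup∘tabulate (extendᶜ T P off) a) e)

      extendᶜ-O : ∀ v → extendᶜ T P off (O v) ≡ lookup T v
      extendᶜ-O v rewrite splitAt-↑ʳ (sum ns) n v = refl

      extendᶜ-B : ∀ t o → extendᶜ T P off (B t o) ≡ lookup (singletonIf (P t) (off t)) o
      extendᶜ-B t o rewrite splitAt-↑ˡ (sum ns) (blockVertex ns t o) n = chosen-blockVertex ns P off t o

    O∈extend⇒ : ∀ {v} → O v ∈ extend T P off → v ∈ T
    O∈extend⇒ {v} O∈ = lookup⇒∈ (trans (sym (extendᶜ-O v)) (∈-extend⇒ O∈))

    O∈extend : ∀ {v} → v ∈ T → O v ∈ extend T P off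
    O∈extend {v} v∈T = ⇒∈-extend (trans (extendᶜ-O v) (∈⇒lookup v∈T))

    X₀∉extend : X₀ ∉ extend T P off
    X₀∉extend X₀∈ with ∈-extend⇒ X₀∈
    ... | ()

    B∈extend⇒ : ∀ {t o} → B t o ∈ extend T P off → P t ≡ true × o ≡ off t
    B∈extend⇒ {t} {o} B∈ = ∈-singletonIf (P t) (off t) o (trans (sym (extendᶜ-B t o)) (∈-extend⇒ B∈))

    B∈extend : ∀ {t o} → P t ≡ true → off t ≡ o → B t o ∈ extend T P off
    B∈extend {t} Pt refl = ⇒∈-extend (trans (extendᶜ-B t (off t))
      (subst (λ b → lookup (singletonIf b (off t)) (off t) ≡ true) (sym Pt) (∈⇒lookup (x∈⁅x⁆ (off t)))))

    ∣extend∣ : ∣ extend T P off ∣ ≡ count P + ∣ T ∣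
    ∣extend∣ = begin
      count (extendᶜ T P off)
        ≡⟨ count-suc (extendᶜ T P off) ⟩
      count (extendᶜ T P off ∘ suc)
        ≡⟨ count-↑ (sum ns) n (extendᶜ T P off ∘ suc) ⟩
      count (λ b → extendᶜ T P off (suc (b ↑ˡ n))) + count (λ v → extendᶜ T P off (O v))
        ≡⟨ cong₂ _+_ (count-cong blocks) (count-cong extendᶜ-O) ⟩
      count (chosen ns P off) + count (lookup T)
        ≡⟨ cong₂ _+_ (count-chosen ns P off) (count-lookup T) ⟩
      count P + ∣ T ∣ ∎
      where
      open ≡-Reasoning
      blocks : ∀ b → extendᶜ T P off (suc (b ↑ˡ n)) ≡ chosen ns P off b
      blocks b rewrite splitAt-↑ˡ (sum ns) b n = refl

  restrict : Subset N → Subset n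
  restrict D = tabulate (λ v → lookup D (O v))

  module _ {D : Subset N} {v : Fin n} where

    restrict-∈ : O v ∈ D → v ∈ restrict D
    restrict-∈ O∈ = lookup⇒∈ (trans (lookup∘tabulate (λ v → lookup D (O v)) v) (∈⇒lookup O∈))

    restrict-∈⇒ : v ∈ restrict D → O v ∈ D
    restrict-∈⇒ v∈ = lookup⇒∈ (trans (sym (lookup∘tabulate (λ v → lookup D (O v)) v)) (∈⇒lookup v∈))

  ∣D∣≥ℓ+∣restrict∣ : ∀ D → (∀ t → ∃[ o ] (B t o ∈ D)) → ℓ + ∣ restrict D ∣ ≤ ∣ D ∣
  ∣D∣≥ℓ+∣restrict∣ D meets = begin
    ℓ + ∣ restrict D ∣
      ≤⟨ +-monoˡ-≤ _ (count-≥-blocks ns (λ b → lookup D (suc (b ↑ˡ n)))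
                                        (λ t → proj₁ (meets t) , ∈⇒lookup (proj₂ (meets t)))) ⟩
    count (λ b → lookup D (suc (b ↑ˡ n))) + count (λ v → lookup D (O v))
      ≡⟨ count-↑ (sum ns) n (lookup D ∘ suc) ⟨
    count (lookup D ∘ suc)
      ≤⟨ ∣p∣≤∣x∷p∣ (lookup D zero) (tabulate (lookup D ∘ suc)) ⟩
    count (lookup D)
      ≡⟨ count-lookup D ⟩
    ∣ D ∣ ∎
    where open ≤-Reasoning

  -- The number of blocks still to be crossed before reaching G.
  distanceᴷ : Kind ℓ n → ℕ
  distanceᴷ (blk t) = ℓ ∸ toℕ t
  distanceᴷ _       = 0

  distance : Fin N → ℕ
  distance a = distanceᴷ (kind ns a)

  distance-B : ∀ t o → distance (B t o) ≡ ℓ ∸ toℕ t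
  distance-B t o = cong distanceᴷ (kind-B t o)

  distance-O : ∀ v → distance (O v) ≡ 0
  distance-O v = cong distanceᴷ (kind-O v)

  module Extension (G′ : Adj N) (G⋆⊆G′ : ∀ {a b} → G⋆ a b ≡ true → G′ a b ≡ true)
                   (sym-G′ : ∀ a b → G′ a b ≡ G′ b a)
                   (T : Subset n) (P : Fin ℓ → Bool) (off : Offsets ns) where

    D : Subset N
    D = extend T P off

    -- K is the graph on V(G) whose connected domination by T is transported to G′.
    extend-isCDS : (h : Fin n) → h ∈ T → h ∈ H → (K : Adj n) → IsCDS K T →
      (∀ {x w} → x ∈ T → K x w ≡ true → ∃[ d ] (d ∈ D × G′ d (O w) ≡ true)) →
      (∀ {x y} → x ∈ T → y ∈ T → K x y ≡ true → WalkIn G′ D (O x) (O y)) →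
      ∃[ d ] (d ∈ D × G′ d X₀ ≡ true) →
      (∀ t o → P t ≡ false → ∃[ d ] (d ∈ D × G′ d (B t o) ≡ true)) →
      (∀ t t′ → P t ≡ true → toℕ t′ ≡ suc (toℕ t) → P t′ ≡ false →
         ∃[ d ] (d ∈ D × G′ (B t (off t)) d ≡ true × distance d < ℓ ∸ toℕ t)) →
      IsCDS G′ D
    extend-isCDS h h∈T h∈H K (dom-K , conn-K) K-dom K-walk X₀-dom unchosen-dom skip-next =
      dom , connected-via-hub sym-G′ (walk-by-descent distance (λ {a} → toward-h (view a)))
      where
      dom : Dominating G′ D
      dom v with view v
      ... | x₀ᵛ = inj₂ X₀-dom
      ... | oldᵛ w with dom-K w
      ...   | inj₁ w∈T = inj₁ (O∈extend w∈T)
      ...   | inj₂ (x , x∈T , e) = inj₂ (K-dom x∈T e)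
      dom v | blockᵛ t o with P t in Pt
      ...   | false = inj₂ (unchosen-dom t o Pt)
      ...   | true with o ≟ off t
      ...     | yes refl = inj₁ (B∈extend Pt refl)
      ...     | no o≢off = inj₂ (B t (off t) , B∈extend Pt refl , G⋆⊆G′ (same-B-B-adj t (o≢off ∘ sym)))

      next-block : ∀ t → P t ≡ true →
        ∃[ b ] (b ∈ D × G′ (B t (off t)) b ≡ true × distance b < ℓ ∸ toℕ t)
      next-block t Pt with suc (toℕ t) ≟ℕ ℓ
      ... | yes last = O h , O∈extend h∈T , G⋆⊆G′ (last-B-H-adj t (off t) h last h∈H) ,
                       subst (_< ℓ ∸ toℕ t) (sym (distance-O h)) (m<n⇒0<n∸m (toℕ<n t))
      ... | no not-last with next-index t not-last
      ...   | t′ , t′≡1+t with P t′ in Pt′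
      ...     | false = skip-next t t′ Pt t′≡1+t Pt′
      ...     | true  = B t′ (off t′) , B∈extend Pt′ refl ,
                        G⋆⊆G′ (next-B-B-adj t (off t) t′ (off t′) t′≡1+t) ,
                        subst (_< ℓ ∸ toℕ t) (sym (trans (distance-B t′ (off t′)) (cong (ℓ ∸_) t′≡1+t)))
                              (∸-monoʳ-< (n<1+n (toℕ t)) (toℕ<n t))

      toward-h : ∀ {a} → View a → a ∈ D →
        WalkIn G′ D a (O h) ⊎ ∃[ b ] (b ∈ D × G′ a b ≡ true × distance b < distance a)
      toward-h x₀ᵛ          X₀∈ = ⊥-elim (X₀∉extend X₀∈)
      toward-h (oldᵛ x)     O∈  = inj₁ (walk-map O O∈extend K-walk (conn-K x h (O∈extend⇒ O∈) h∈T))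
      toward-h (blockᵛ t o) B∈  with B∈extend⇒ B∈
      ... | Pt , refl = inj₂ (subst (λ δ → ∃[ b ] (b ∈ D × G′ (B t (off t)) b ≡ true × distance b < δ))
                                   (sym (distance-B t (off t))) (next-block t Pt))

  module LowerBound (1≤ℓ : 1 ≤ ℓ) (clique-H : ∀ u v → u ∈ H → v ∈ H → u ≢ v → G u v ≡ true)
                    {k} (1<k : 1 < k) (γc≥k : ∀ S → IsCDS G S → k ≤ ∣ S ∣) (w₀ : Fin n)
                    (D : Subset N) (cds : IsCDS G⋆ D) where

    private
      dom : Dominating G⋆ D
      dom = proj₁ cds

      conn : InducesConnected G⋆ D
      conn = proj₂ cds

    Dᴳ : Subset n
    Dᴳ = restrict D

    -- Otherwise all of V(G) lies in N(G_ℓ) ∩ V(G) = H, and then γc(G) = 1.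
    meets-G : ∃[ g ] (O g ∈ D)
    meets-G with any? (λ v → O v ∈? D)
    ... | yes found = found
    ... | no ¬found = ⊥-elim (<⇒≱ 1<k (≤-trans (γc≥k ⁅ w₀ ⁆ single) (≤-reflexive (∣⁅x⁆∣≡1 w₀))))
      where
      everything-in-H : ∀ w → w ∈ H
      everything-in-H w with dom (O w)
      ... | inj₁ O∈D = ⊥-elim (¬found (w , O∈D))
      ... | inj₂ (d , d∈D , e) with O-neighbour (view d) w e
      ...   | inj₁ (u , refl , _)          = ⊥-elim (¬found (u , d∈D))
      ...   | inj₂ (_ , _ , _ , _ , w∈H) = w∈H
      single : IsCDS G ⁅ w₀ ⁆
      single = dominating-vertex-isCDS G w₀
        (λ v v≢w₀ → clique-H w₀ v (everything-in-H w₀) (everything-in-H v) (v≢w₀ ∘ sym))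

    near-X₀ : ∃[ d ] (d ∈ D × level d ≤ 1)
    near-X₀ with dom X₀
    ... | inj₁ X₀∈D = X₀ , X₀∈D , z≤n
    ... | inj₂ (d , d∈D , e) with X₀-neighbour (view d) e
    ...   | t , o , refl , t≡0 = d , d∈D , ≤-reflexive (trans (level-B t o) (cong suc t≡0))

    meets-every-block : ∀ t → ∃[ o ] (B t o ∈ D)
    meets-every-block t with near-X₀ | meets-G
    ... | d , d∈D , level-d≤1 | g , O∈D
      with walk-visits-level level (λ {a} {b} → level-edge {a} {b}) (conn d (O g) d∈D O∈D) (suc (toℕ t))
             (≤-trans level-d≤1 (s≤s z≤n)) (≤-trans (s≤s (<⇒≤ (toℕ<n t))) (≤-reflexive (sym (level-O g))))
    ...   | c , c∈D , level-c with view c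
    ...     | blockᵛ t′ o with toℕ-injective (suc-injective (trans (sym (level-B t′ o)) level-c))
    ...       | refl = o , c∈D
    meets-every-block t | _ | _ | c , c∈D , level-c | oldᵛ x =
      ⊥-elim (<-irrefl refl (≤-trans (toℕ<n t) (≤-reflexive (suc-injective (trans (sym (level-O x)) level-c)))))
    meets-every-block t | _ | _ | c , c∈D , level-c | x₀ᵛ with level-c
    ... | ()

    -- A walk of G⋆[D] ending in G projects to G[Dᴳ]: an excursion out of G
    -- passes through G_ℓ, so it leaves and re-enters G inside the clique H.
    Projection : ∀ {a} → View a → Fin n → Set
    Projection (oldᵛ x) y = WalkIn G Dᴳ x y
    Projection _        y = ∃[ h ] (h ∈ H × h ∈ Dᴳ × WalkIn G Dᴳ h y)

    private
      enter-H : ∀ {x y} → x ∈ H → x ∈ Dᴳ → ∃[ h ] (h ∈ H × h ∈ Dᴳ × WalkIn G Dᴳ h y) → WalkIn G Dᴳ x y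
      enter-H {x} x∈H x∈Dᴳ (h , h∈H , _ , walk) with x ≟ h
      ... | yes refl = walk
      ... | no x≢h   = step x∈Dᴳ (clique-H x h x∈H h∈H x≢h) walk

      project-step : ∀ {a v y} (va : View a) (vv : View v) → a ∈ D → v ∈ D → G⋆ a v ≡ true →
        Projection vv y → Projection va y
      project-step (oldᵛ x) (oldᵛ x′) a∈D _ e walk =
        step (restrict-∈ a∈D) (trans (sym (O-O-adj x x′)) e) walk
      project-step (oldᵛ x) x₀ᵛ _ _ e _ = ⊥-elim (X₀-O-nonadj {x} (G⋆-flip (O x) X₀ e))
      project-step (oldᵛ x) (blockᵛ t o) a∈D _ e r =
        enter-H (B-O-adj⇒H {t} {o} {x} (G⋆-flip (O x) (B t o) e)) (restrict-∈ a∈D) r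
      project-step x₀ᵛ (oldᵛ x′) _ _ e _ = ⊥-elim (X₀-O-nonadj {x′} e)
      project-step (blockᵛ t o) (oldᵛ x′) _ v∈D e walk = x′ , B-O-adj⇒H {t} {o} e , restrict-∈ v∈D , walk
      project-step x₀ᵛ          x₀ᵛ          _ _ _ r = r
      project-step x₀ᵛ          (blockᵛ _ _) _ _ _ r = r
      project-step (blockᵛ _ _) x₀ᵛ          _ _ _ r = r
      project-step (blockᵛ _ _) (blockᵛ _ _) _ _ _ r = r

    project : ∀ {a b y} (va : View a) → b ≡ O y → WalkIn G⋆ D a b → Projection va y
    project x₀ᵛ          ()   (stop _)
    project (blockᵛ t o) B≡O  (stop _)   = ⊥-elim (B≢O B≡O)
    project (oldᵛ x)     O≡O  (stop O∈D) rewrite O-injective O≡O = stop (restrict-∈ O∈D)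
    project va           b≡Oy (step {v = v} a∈D e p) =
      project-step va (view v) a∈D (walk-head p) e (project (view v) b≡Oy p)

    H-meets-D : ∃[ h ] (h ∈ H × O h ∈ D)
    H-meets-D with near-X₀ | meets-G
    ... | d , d∈D , level-d≤1 | g , O∈D with view d | project (view d) refl (conn d (O g) d∈D O∈D)
    ...   | x₀ᵛ        | h , h∈H , h∈Dᴳ , _ = h , h∈H , restrict-∈⇒ h∈Dᴳ
    ...   | blockᵛ _ _ | h , h∈H , h∈Dᴳ , _ = h , h∈H , restrict-∈⇒ h∈Dᴳ
    ...   | oldᵛ x     | _ = ⊥-elim (level-O≰ℓ x (≤-trans level-d≤1 1≤ℓ))

    restrict-dominating : Dominating G Dᴳ
    restrict-dominating w with dom (O w)
    ... | inj₁ O∈D = inj₁ (restrict-∈ O∈D)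
    ... | inj₂ (d , d∈D , e) with O-neighbour (view d) w e
    ...   | inj₁ (u , refl , Guw) = inj₂ (u , restrict-∈ d∈D , Guw)
    ...   | inj₂ (_ , _ , _ , _ , w∈H) with H-meets-D
    ...     | h , h∈H , O∈D with h ≟ w
    ...       | yes refl = inj₁ (restrict-∈ O∈D)
    ...       | no h≢w   = inj₂ (h , restrict-∈ O∈D , clique-H h w h∈H w∈H h≢w)

    restrict-connected : InducesConnected G Dᴳ
    restrict-connected x y x∈ y∈ = project (oldᵛ x) refl (conn (O x) (O y) (restrict-∈⇒ x∈) (restrict-∈⇒ y∈))

    k+ℓ≤∣D∣ : k + ℓ ≤ ∣ D ∣
    k+ℓ≤∣D∣ = begin
      k + ℓ        ≡⟨ +-comm k ℓ ⟩
      ℓ + k        ≤⟨ +-monoʳ-≤ ℓ (γc≥k Dᴳ (restrict-dominating , restrict-connected)) ⟩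
      ℓ + ∣ Dᴳ ∣   ≤⟨ ∣D∣≥ℓ+∣restrict∣ D meets-every-block ⟩
      ∣ D ∣        ∎
      where open ≤-Reasoning

module GstarCriticality {k ℓ n : ℕ} (G : Adj n) (H : Subset n) (ns : Vec ℕ ℓ)
  (1<k : 1 < k) (1≤ℓ : 1 ≤ ℓ) (critical : Critical G k) (maximal : IsMaximalClique G H)
  (γc-sets-via-H : ∀ v → ∃[ S ] (IsCDS G S × ∣ S ∣ ≡ k × v ∈ S × ∃[ h ] (h ∈ S × h ∈ H)))
  (small-cds-via-H : ∀ u v → u ≢ v → G u v ≡ false →
     ∃[ D ] (IsCDS (addEdge G u v) D × ∃[ h ] (h ∈ D × h ∈ H) × ∣ D ∣ < k))
  (blocks-nonempty : ∀ i → 1 ≤ lookup ns i) where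

  open Construction G H ns (proj₁ critical)

  w₀ : Fin n
  w₀ = proj₁ (proj₁ (proj₂ critical))

  γc-G : GammaC≡ G k
  γc-G = proj₁ (proj₂ (proj₂ critical))

  clique-H : ∀ u v → u ∈ H → v ∈ H → u ≢ v → G u v ≡ true
  clique-H = proj₁ maximal

  t₀ : Fin ℓ
  t₀ = fromℕ< 1≤ℓ

  t₀≡0 : toℕ t₀ ≡ 0
  t₀≡0 = toℕ-fromℕ< 1≤ℓ

  off₀ : Offsets ns
  off₀ t = fromℕ< (blocks-nonempty t)

  every : Fin ℓ → Bool
  every _ = true

  all-but : Fin ℓ → Fin ℓ → Bool
  all-but s t = not (does (t ≟ s))

  all-but-true : ∀ {s t} → t ≢ s → all-but s t ≡ true
  all-but-true {s} {t} t≢s with t ≟ s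
  ... | yes t≡s = ⊥-elim (t≢s t≡s)
  ... | no _    = refl

  all-but-false : ∀ {s t} → all-but s t ≡ false → t ≡ s
  all-but-false {s} {t} _ with t ≟ s
  ... | yes t≡s = t≡s

  ∣extend-every∣ : ∀ T off → ∣ extend T every off ∣ ≡ ℓ + ∣ T ∣
  ∣extend-every∣ T off = trans ∣extend∣ (cong (_+ ∣ T ∣) (count-true ℓ))

  ∣extend-all-but∣ : ∀ T s off → suc ∣ extend T (all-but s) off ∣ ≡ ℓ + ∣ T ∣
  ∣extend-all-but∣ T s off = trans (cong suc ∣extend∣) (cong (_+ ∣ T ∣) (count-all-but-one s))

  G-lifts : ∀ {x w} → G x w ≡ true → G⋆ (O x) (O w) ≡ true
  G-lifts {x} {w} e = trans (O-O-adj x w) e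

  module Supergraph (G′ : Adj N) (G⋆⊆G′ : ∀ {a b} → G⋆ a b ≡ true → G′ a b ≡ true)
                    (sym-G′ : ∀ a b → G′ a b ≡ G′ b a) where

    open Extension G′ G⋆⊆G′ sym-G′ public

    Small : Set
    Small = ∃[ D ] (IsCDS G′ D × ∣ D ∣ < k + ℓ)

    flip : ∀ {a b} → G′ a b ≡ true → G′ b a ≡ true
    flip {a} {b} e = trans (sym-G′ b a) e

    module _ {K : Adj n} (K-lifts : ∀ {x w} → K x w ≡ true → G′ (O x) (O w) ≡ true)
             {T : Subset n} {P : Fin ℓ → Bool} {off : Offsets ns} where

      lifted-dom : ∀ {x w} → x ∈ T → K x w ≡ true → ∃[ d ] (d ∈ D T P off × G′ d (O w) ≡ true)
      lifted-dom {x} x∈T e = O x , O∈extend x∈T , K-lifts e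

      lifted-walk : ∀ {x y} → x ∈ T → y ∈ T → K x y ≡ true → WalkIn G′ (D T P off) (O x) (O y)
      lifted-walk x∈T y∈T e = edge-walk (O∈extend x∈T) (O∈extend y∈T) (K-lifts e)

    every-isCDS : (T : Subset n) (off : Offsets ns) (h : Fin n) → h ∈ T → h ∈ H →
      (K : Adj n) → IsCDS K T →
      (∀ {x w} → x ∈ T → K x w ≡ true → ∃[ d ] (d ∈ D T every off × G′ d (O w) ≡ true)) →
      (∀ {x y} → x ∈ T → y ∈ T → K x y ≡ true → WalkIn G′ (D T every off) (O x) (O y)) →
      IsCDS G′ (D T every off)
    every-isCDS T off h h∈T h∈H K cds K-dom K-walk =
      extend-isCDS T every off h h∈T h∈H K cds K-dom K-walk
        (B t₀ (off t₀) , B∈extend refl refl , G⋆⊆G′ (first-B-X₀-adj t₀ (off t₀) t₀≡0))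
        (λ _ _ ())
        (λ _ _ _ _ ())

    every-small : (T : Subset n) (off : Offsets ns) (h : Fin n) → h ∈ T → h ∈ H →
      (K : Adj n) → IsCDS K T → ∣ T ∣ < k →
      (∀ {x w} → x ∈ T → K x w ≡ true → ∃[ d ] (d ∈ D T every off × G′ d (O w) ≡ true)) →
      (∀ {x y} → x ∈ T → y ∈ T → K x y ≡ true → WalkIn G′ (D T every off) (O x) (O y)) →
      Small
    every-small T off h h∈T h∈H K cds ∣T∣<k K-dom K-walk =
      D T every off , every-isCDS T off h h∈T h∈H K cds K-dom K-walk ,
      subst (_< k + ℓ) (sym (∣extend-every∣ T off)) (subst (ℓ + ∣ T ∣ <_) (+-comm ℓ k) (+-monoʳ-< ℓ ∣T∣<k))

    -- Skipping block s saves one vertex; block s must then be dominated from elsewhere.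
    all-but-small : (T : Subset n) → IsCDS G T → ∣ T ∣ ≡ k → (h : Fin n) → h ∈ T → h ∈ H →
      (s : Fin ℓ) (off : Offsets ns) →
      ∃[ d ] (d ∈ D T (all-but s) off × G′ d X₀ ≡ true) →
      (∀ o → ∃[ d ] (d ∈ D T (all-but s) off × G′ d (B s o) ≡ true)) →
      (∀ t → toℕ s ≡ suc (toℕ t) →
         ∃[ d ] (d ∈ D T (all-but s) off × G′ (B t (off t)) d ≡ true × distance d < ℓ ∸ toℕ t)) →
      Small
    all-but-small T cds ∣T∣≡k h h∈T h∈H s off X₀-dom s-dom before-s =
      D T (all-but s) off ,
      extend-isCDS T (all-but s) off h h∈T h∈H G cds
        (lifted-dom (G⋆⊆G′ ∘ G-lifts)) (lifted-walk (G⋆⊆G′ ∘ G-lifts)) X₀-dom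
        (λ t o skipped → skipped-dom (all-but-false skipped) o)
        (λ t t′ _ t′≡1+t skipped → before-s t (subst (λ i → toℕ i ≡ suc (toℕ t)) (all-but-false skipped) t′≡1+t)) ,
      ≤-reflexive (trans (∣extend-all-but∣ T s off) (trans (cong (ℓ +_) ∣T∣≡k) (+-comm ℓ k)))
      where
      skipped-dom : ∀ {t} → t ≡ s → ∀ o → ∃[ d ] (d ∈ D T (all-but s) off × G′ d (B t o) ≡ true)
      skipped-dom refl = s-dom

    first-block-dominated : ∀ T off {h} → h ∈ T → h ∈ H →
      ∀ o → ∃[ d ] (d ∈ D T (all-but t₀) off × G′ d (B t₀ o) ≡ true)
    first-block-dominated T off {h} h∈T h∈H o with suc (toℕ t₀) ≟ℕ ℓ
    ... | yes last = O h , O∈extend h∈T , G⋆⊆G′ (G⋆-flip (B t₀ o) (O h) (last-B-H-adj t₀ o h last h∈H))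
    ... | no not-last with next-index t₀ not-last
    ...   | t₁ , t₁≡1+t₀ =
      B t₁ (off t₁) , B∈extend (all-but-true t₁≢t₀) refl ,
      G⋆⊆G′ (G⋆-flip (B t₀ o) (B t₁ (off t₁)) (next-B-B-adj t₀ o t₁ (off t₁) t₁≡1+t₀))
      where
      t₁≢t₀ : t₁ ≢ t₀
      t₁≢t₀ refl = 1+n≢n (sym t₁≡1+t₀)

    nothing-before-t₀ : ∀ (t : Fin ℓ) → toℕ t₀ ≢ suc (toℕ t)
    nothing-before-t₀ t t₀≡1+t = 0≢1+n (trans (sym t₀≡0) t₀≡1+t)

    -- For a new edge at x₀, drop G₁; it is dominated by G₂, or by h ∈ H when ℓ = 1.
    X₀-old : ∀ v → G′ (O v) X₀ ≡ true → Small
    X₀-old v e with γc-sets-via-H v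
    ... | S , cds , ∣S∣≡k , v∈S , h , h∈S , h∈H =
      all-but-small S cds ∣S∣≡k h h∈S h∈H t₀ off₀ (O v , O∈extend v∈S , e)
        (first-block-dominated S off₀ h∈S h∈H) (λ t → ⊥-elim ∘ nothing-before-t₀ t)

    X₀-block : ∀ i o → toℕ i ≢ 0 → G′ (B i o) X₀ ≡ true → Small
    X₀-block i o i≢0 e with γc-sets-via-H w₀
    ... | S , cds , ∣S∣≡k , _ , h , h∈S , h∈H =
      all-but-small S cds ∣S∣≡k h h∈S h∈H t₀ off
        (B i o , B∈extend (all-but-true i≢t₀) (setOffset-same off₀ i o) , e)
        (first-block-dominated S off h∈S h∈H) (λ t → ⊥-elim ∘ nothing-before-t₀ t)
      where
      off : Offsets ns
      off = setOffset off₀ i o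
      i≢t₀ : i ≢ t₀
      i≢t₀ refl = i≢0 t₀≡0

    -- Block i is represented by B i o, which bypasses the skipped block s = i + 1 through the new edge.
    skip-after : ∀ T → IsCDS G T → ∣ T ∣ ≡ k → ∀ {h} → h ∈ T → h ∈ H →
      ∀ i o s → toℕ s ≡ suc (toℕ i) → (off : Offsets ns) → off i ≡ o →
      ∃[ d ] (d ∈ D T (all-but s) off × G′ (B i o) d ≡ true × distance d < ℓ ∸ toℕ i) →
      Small
    skip-after T cds ∣T∣≡k {h} h∈T h∈H i o s s≡1+i off off-i≡o beyond =
      all-but-small T cds ∣T∣≡k h h∈T h∈H s off
        (B t₀ (off t₀) , B∈extend (all-but-true t₀≢s) refl , G⋆⊆G′ (first-B-X₀-adj t₀ (off t₀) t₀≡0))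
        (λ o′ → B i o , B∈extend (all-but-true i≢s) off-i≡o , G⋆⊆G′ (next-B-B-adj i o s o′ s≡1+i))
        before-s
      where
      t₀≢s : t₀ ≢ s
      t₀≢s t₀≡s = 0≢1+n (trans (sym t₀≡0) (trans (cong toℕ t₀≡s) s≡1+i))
      i≢s : i ≢ s
      i≢s i≡s = 1+n≢n (sym (trans (cong toℕ i≡s) s≡1+i))
      before-s : ∀ t → toℕ s ≡ suc (toℕ t) →
        ∃[ d ] (d ∈ D T (all-but s) off × G′ (B t (off t)) d ≡ true × distance d < ℓ ∸ toℕ t)
      before-s t s≡1+t with toℕ-injective {i = t} {j = i} (suc-injective (trans (sym s≡1+t) s≡1+i))
      ... | refl rewrite off-i≡o = beyond

    far-blocks : ∀ i o j p → 2 + toℕ i ≤ toℕ j → G′ (B i o) (B j p) ≡ true → Small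
    far-blocks i o j p i+2≤j e with γc-sets-via-H w₀ | next-index i (below-not-last i j (≤-trans (n≤1+n _) i+2≤j))
    ... | S , cds , ∣S∣≡k , _ , h , h∈S , h∈H | s , s≡1+i =
      skip-after S cds ∣S∣≡k h∈S h∈H i o s s≡1+i off off-i≡o
        (B j p , B∈extend (all-but-true j≢s) (setOffset-same (setOffset off₀ i o) j p) , e ,
         subst (_< ℓ ∸ toℕ i) (sym (distance-B j p)) (∸-monoʳ-< (≤-trans (n≤1+n _) i+2≤j) (<⇒≤ (toℕ<n j))))
      where
      off : Offsets ns
      off = setOffset (setOffset off₀ i o) j p
      j≢s : j ≢ s
      j≢s j≡s = 1+n≰n (≤-trans i+2≤j (≤-reflexive (trans (cong toℕ j≡s) s≡1+i)))
      off-i≡o : off i ≡ o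
      off-i≡o = trans (setOffset-other (setOffset off₀ i o) j p i≢j) (setOffset-same off₀ i o)
        where
        i≢j : i ≢ j
        i≢j refl = 1+n≰n (≤-trans (n≤1+n _) i+2≤j)

    block-old : ∀ i o v → suc (toℕ i) ≢ ℓ → G′ (B i o) (O v) ≡ true → Small
    block-old i o v i-not-last e with γc-sets-via-H v | next-index i i-not-last
    ... | S , cds , ∣S∣≡k , v∈S , h , h∈S , h∈H | s , s≡1+i =
      skip-after S cds ∣S∣≡k h∈S h∈H i o s s≡1+i (setOffset off₀ i o) (setOffset-same off₀ i o)
        (O v , O∈extend v∈S , e , subst (_< ℓ ∸ toℕ i) (sym (distance-O v)) (m<n⇒0<n∸m (toℕ<n i)))

    old-old : ∀ x y → x ≢ y → G x y ≡ false → G′ (O x) (O y) ≡ true → Small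
    old-old x y x≢y nonadj e with small-cds-via-H x y x≢y nonadj
    ... | T , cds , h , (h∈T , h∈H) , ∣T∣<k =
      every-small T off₀ h h∈T h∈H (addEdge G x y) cds ∣T∣<k (lifted-dom lifts) (lifted-walk lifts)
      where
      lifts : ∀ {u w} → addEdge G x y u w ≡ true → G′ (O u) (O w) ≡ true
      lifts {u} {w} e′ with addEdge-cases G x y u w e′
      ... | inj₁ present              = G⋆⊆G′ (G-lifts present)
      ... | inj₂ (inj₁ (refl , refl)) = e
      ... | inj₂ (inj₂ (refl , refl)) = flip e

    -- B i o, adjacent to all of H, simulates the edge uv for some u ∈ H not adjacent to v.
    last-old : ∀ i o v → suc (toℕ i) ≡ ℓ → v ∉ H → G′ (B i o) (O v) ≡ true → Small
    last-old i o v last v∉H e with proj₂ maximal v v∉H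
    ... | u , u∈H , nonadj with small-cds-via-H u v (λ u≡v → v∉H (subst (_∈ H) u≡v u∈H)) nonadj
    ...   | T , cds , h , (h∈T , h∈H) , ∣T∣<k =
      every-small T off h h∈T h∈H (addEdge G u v) cds ∣T∣<k uv-dom uv-walk
      where
      off : Offsets ns
      off = setOffset off₀ i o
      Bio∈D : B i o ∈ D T every off
      Bio∈D = B∈extend refl (setOffset-same off₀ i o)
      Bio-u : G′ (B i o) (O u) ≡ true
      Bio-u = G⋆⊆G′ (last-B-H-adj i o u last u∈H)
      uv-dom : ∀ {x w} → x ∈ T → addEdge G u v x w ≡ true → ∃[ d ] (d ∈ D T every off × G′ d (O w) ≡ true)
      uv-dom {x} {w} x∈T e′ with addEdge-cases G u v x w e′
      ... | inj₁ present              = O x , O∈extend x∈T , G⋆⊆G′ (G-lifts present)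
      ... | inj₂ (inj₁ (refl , refl)) = B i o , Bio∈D , e
      ... | inj₂ (inj₂ (refl , refl)) = B i o , Bio∈D , Bio-u
      uv-walk : ∀ {x y} → x ∈ T → y ∈ T → addEdge G u v x y ≡ true → WalkIn G′ (D T every off) (O x) (O y)
      uv-walk {x} {y} x∈T y∈T e′ with addEdge-cases G u v x y e′
      ... | inj₁ present = edge-walk (O∈extend x∈T) (O∈extend y∈T) (G⋆⊆G′ (G-lifts present))
      ... | inj₂ (inj₁ (refl , refl)) =
        step (O∈extend x∈T) (flip Bio-u) (edge-walk Bio∈D (O∈extend y∈T) e)
      ... | inj₂ (inj₂ (refl , refl)) =
        step (O∈extend x∈T) (flip e) (edge-walk Bio∈D (O∈extend y∈T) Bio-u)

    small-by-views : ∀ {a b} → View a → View b → a ≢ b → G⋆ a b ≡ false → G′ a b ≡ true → Small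
    small-by-views x₀ᵛ          x₀ᵛ          a≢b _ _ = ⊥-elim (a≢b refl)
    small-by-views x₀ᵛ          (blockᵛ t o) _ nonadj e =
      X₀-block t o (λ t≡0 → true-and-false (G⋆-flip (B t o) X₀ (first-B-X₀-adj t o t≡0)) nonadj) (flip e)
    small-by-views (blockᵛ t o) x₀ᵛ          _ nonadj e =
      X₀-block t o (λ t≡0 → true-and-false (first-B-X₀-adj t o t≡0) nonadj) e
    small-by-views x₀ᵛ          (oldᵛ v)     _ _ e = X₀-old v (flip e)
    small-by-views (oldᵛ v)     x₀ᵛ          _ _ e = X₀-old v e
    small-by-views (oldᵛ x)     (oldᵛ y)     a≢b nonadj e =
      old-old x y (a≢b ∘ cong O) (trans (sym (O-O-adj x y)) nonadj) e
    small-by-views (blockᵛ t o) (blockᵛ t′ o′) a≢b nonadj e with nonadjacent-blocks-far t o t′ o′ a≢b nonadj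
    ... | inj₁ t+2≤t′ = far-blocks t o t′ o′ t+2≤t′ e
    ... | inj₂ t′+2≤t = far-blocks t′ o′ t o t′+2≤t (flip e)
    small-by-views (blockᵛ t o) (oldᵛ v) _ nonadj e with suc (toℕ t) ≟ℕ ℓ
    ... | yes last    = last-old t o v last (λ v∈H → true-and-false (last-B-H-adj t o v last v∈H) nonadj) e
    ... | no not-last = block-old t o v not-last e
    small-by-views (oldᵛ v) (blockᵛ t o) _ nonadj e with suc (toℕ t) ≟ℕ ℓ
    ... | yes last    =
      last-old t o v last (λ v∈H → true-and-false (G⋆-flip (B t o) (O v) (last-B-H-adj t o v last v∈H)) nonadj) (flip e)
    ... | no not-last = block-old t o v not-last (flip e)

  addEdge-small : ∀ a b → a ≢ b → G⋆ a b ≡ false → ∃[ D ] (IsCDS (addEdge G⋆ a b) D × ∣ D ∣ < k + ℓ)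
  addEdge-small a b a≢b nonadj =
    small-by-views (view a) (view b) a≢b nonadj (addEdge-joins G⋆ a b)
    where open Supergraph (addEdge G⋆ a b) (λ {x} {y} → addEdge-⊇ G⋆ a b x y) (addEdge-sym G⋆ a b G⋆-sym)

  G⋆-simple : IsSimple G⋆
  G⋆-simple = G⋆-sym , G⋆-loopless

  γc-set : ∃[ D ] (IsCDS G⋆ D × ∣ D ∣ ≡ k + ℓ)
  γc-set with γc-sets-via-H w₀
  ... | S , cds , ∣S∣≡k , _ , h , h∈S , h∈H =
    D S every off₀ , every-isCDS S off₀ h h∈S h∈H G cds (lifted-dom G-lifts) (lifted-walk G-lifts) ,
    trans (∣extend-every∣ S off₀) (trans (cong (ℓ +_) ∣S∣≡k) (+-comm ℓ k))
    where open Supergraph G⋆ (λ e → e) G⋆-sym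

  G⋆-connected : Connected G⋆
  G⋆-connected = cds⇒connected G⋆ G⋆-sym (proj₁ (proj₂ γc-set)) X₀

  G⋆-γc : GammaC≡ G⋆ (k + ℓ)
  G⋆-γc = γc-set , λ D cds → LowerBound.k+ℓ≤∣D∣ 1≤ℓ clique-H 1<k (proj₂ γc-G) w₀ D cds

  G⋆-adding-edge-lowers-γc : ∀ a b → a ≢ b → G⋆ a b ≡ false →
    ∃[ m ] (GammaC≡ (addEdge G⋆ a b) m × m < k + ℓ)
  G⋆-adding-edge-lowers-γc a b a≢b nonadj with addEdge-small a b a≢b nonadj
  ... | D , cds , ∣D∣<k+ℓ with γc-exists (addEdge G⋆ a b) D cds
  ...   | m , γc , m≤∣D∣ = m , γc , ≤-<-trans m≤∣D∣ ∣D∣<k+ℓ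

theorem5p2 : ∀ (k ℓ n : ℕ) (G : Adj n) (H : Subset n) (ns : Vec ℕ ℓ) →
    4 ≤ k → 1 ≤ ℓ →
    Critical G k →
    IsMaximalClique G H → 2 ≤ ∣ H ∣ →
    (∀ (v : Fin n) → ∃[ S ] (IsCDS G S × ∣ S ∣ ≡ k × v ∈ S × ∃[ h ] (h ∈ S × h ∈ H))) →
    (∀ (u v : Fin n) → u ≢ v → G u v ≡ false →
       ∃[ D ] (IsCDS (addEdge G u v) D × ∃[ h ] (h ∈ D × h ∈ H) × ∣ D ∣ < k)) →
    (∀ (i : Fin ℓ) → 1 ≤ lookup ns i) →
    Critical (Gstar G H ns) (k + ℓ)
theorem5p2 k ℓ n G H ns 4≤k 1≤ℓ critical maximal _ γc-sets-via-H small-cds-via-H blocks-nonempty =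
  G⋆-simple , G⋆-connected , G⋆-γc , G⋆-adding-edge-lowers-γc
  where
  open GstarCriticality G H ns (≤-trans (s≤s (s≤s z≤n)) 4≤k) 1≤ℓ critical maximal
         γc-sets-via-H small-cds-via-H blocks-nonempty
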